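{- For every $\alpha\in\Phi_{XY}$, the formula $[\alpha]\alpha$ is valid. However, there exists $\alpha\in\Phi_{XY}$ such that $\alpha\rightarrow\Box\alpha$ is not valid.
   Context: Let $\mathsf{AP}$ be a countable set of atomic propositions. The language $\Phi_{XY}$ is given by $\alpha ::= p \mid \bot \mid \neg\alpha \mid (\alpha\land\alpha) \mid \mathtt{X}\alpha \mid \mathtt{Y}\alpha$ with $p\in\mathsf{AP}$. The language $\Phi$ is given by $\phi ::= p \mid \bot \mid \neg\phi \mid (\phi\land\phi) \mid \mathtt{X}\phi \mid \mathtt{Y}\phi \mid [\alpha]\phi$ with $\alpha\in\Phi_{XY}$. Abbreviations: $\top,\lor,\rightarrow,\leftrightarrow$ as usual; $\langle\alpha\rangle\phi:=\neg[\alpha]\neg\phi$; $\Box\phi:=[\top]\phi$; $\Diamond\phi:=\neg\Box\neg\phi$. A model is $M=(W,<,V)$ where $W$ is a nonempty set, $<$ is a serial binary relation on $W$ such that there is $r\in W$ (the root) with: for every $w\in W$ there is a unique finite sequence $x_0,\dots,x_n$ with $x_0=r$, $x_n=w$, $x_0<x_1<\dots<x_n$; and $V:\mathsf{AP}\to\mathcal P(W)$. A timeline is an infinite sequence $\pi=x_0,x_1,\dots$ with $x_0=r$ and $x_k<x_{k+1}$ for all $k$; $\pi[i]:=x_i$; $TL(M)$ is the set of timelines; instants are natural numbers. A context for $M$ is a finite (possibly empty) set $C$ of subsets of $TL(M)$; $AT(C):=TL(M)\cap\bigcap_{R\in C}R$ (so $AT(\emptyset)=TL(M)$). A contextualized pointed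 model is $(M,C,\pi,i)$ with $C$ a context for $M$, $\pi\in AT(C)$, $i\in\mathbb N$. Satisfaction $M,C,\pi,i\Vdash\phi$ (for $\pi\in TL(M)$): $p$ iff $\pi[i]\in V(p)$; $\bot$ never; $\neg,\land$ classically; $\mathtt{X}\phi$ iff $M,C,\pi,i+1\Vdash\phi$; $\mathtt{Y}\phi$ iff $i=0$ or $M,C,\pi,i-1\Vdash\phi$; $[\alpha]\phi$ iff $M,C^{\alpha}_i,\pi',i\Vdash\phi$ for every $\pi'\in AT(C^{\alpha}_i)$, where $C^{\alpha}_i:=C\cup\{\|\alpha\|_i\}$ and $\|\alpha\|_i:=\{\pi'\in TL(M): M,C,\pi',i\Vdash\alpha\}$. A formula is valid if it is true at every contextualized pointed model. -}

module Defs where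

open import Data.Nat using (ℕ; zero; suc)
open import Data.Product using (Σ; ∃; _×_; _,_)
open import Data.Sum using (_⊎_)
open import Data.Empty using (⊥)
open import Data.Unit using (⊤)
open import Data.Maybe using (just)
open import Data.List using (List; head; last)
import Data.List
open import Data.List.Relation.Unary.Linked using (Linked)
open import Relation.Nullary using (¬_)
open import Relation.Binary.PropositionalEquality using (_≡_)

AP : Set
AP = ℕ

data FormXY : Set where
  atomXY : AP → FormXY
  botXY  : FormXY
  negXY  : FormXY → FormXY
  andXY  : FormXY → FormXY → FormXY
  XXY    : FormXY → FormXY
  YXY    : FormXY → FormXY

data Form : Set where
  atom : AP → Form
  bot  : Form
  neg  : Form → Form
  and  : Form → Form → Form
  X    : Form → Form
  Y    : Form → Form
  box  : FormXY → Form → Form      -- [α]φ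

ι : FormXY → Form
ι (atomXY p)  = atom p
ι botXY       = bot
ι (negXY a)   = neg (ι a)
ι (andXY a b) = and (ι a) (ι b)
ι (XXY a)     = X (ι a)
ι (YXY a)     = Y (ι a)

topXY : FormXY
topXY = negXY botXY

_⇒_ : Form → Form → Form
a ⇒ b = neg (and a (neg b))

□ : Form → Form
□ φ = box topXY φ

record Model : Set₁ where
  field
    W        : Set
    _<_      : W → W → Set
    serial   : ∀ w → ∃ λ v → w < v
    root     : W
  IsChainTo : W → List W → Set
  IsChainTo w xs = (head xs ≡ just root) × (last xs ≡ just w) × Linked _<_ xs
  field
    chainExists : ∀ w → ∃ λ xs → IsChainTo w xs
    chainUnique : ∀ w xs ys → IsChainTo w xs → IsChainTo w ys → xs ≡ ys
    V        : AP → W → Set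
  -- (W is nonempty since it contains root.)

open Model public

record TL (M : Model) : Set where
  field
    seq   : ℕ → W M
    start : seq 0 ≡ root M
    step  : ∀ k → _<_ M (seq k) (seq (suc k))

open TL public

Context : Model → Set₁
Context M = List (TL M → Set)

AT : (M : Model) → Context M → TL M → Set
AT M Data.List.[] π = ⊤
AT M (R Data.List.∷ C) π = R π × AT M C π

_∷C_ : {M : Model} → (TL M → Set) → Context M → Context M
R ∷C C = Data.List._∷_ R C

-- Satisfaction for Φ_XY (in a context; the context is irrelevant for Φ_XY
-- but kept to match the paper's definition)
SatXY : (M : Model) → Context M → TL M → ℕ → FormXY → Set
SatXY M C π i (atomXY p)  = V M p (seq π i)
SatXY M C π i botXY       = ⊥
SatXY M C π i (negXY a)   = ¬ SatXY M C π i a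
SatXY M C π i (andXY a b) = SatXY M C π i a × SatXY M C π i b
SatXY M C π i (XXY a)     = SatXY M C π (suc i) a
SatXY M C π zero (YXY a)    = ⊤
SatXY M C π (suc i) (YXY a) = SatXY M C π i a

ext : (M : Model) → Context M → FormXY → ℕ → TL M → Set
ext M C α i π' = SatXY M C π' i α

Sat : (M : Model) → Context M → TL M → ℕ → Form → Set
Sat M C π i (atom p)  = V M p (seq π i)
Sat M C π i bot       = ⊥
Sat M C π i (neg φ)   = ¬ Sat M C π i φ
Sat M C π i (and φ ψ) = Sat M C π i φ × Sat M C π i ψ
Sat M C π i (X φ)     = Sat M C π (suc i) φ
Sat M C π zero (Y φ)    = ⊤
Sat M C π (suc i) (Y φ) = Sat M C π i φ
Sat M C π i (box α φ) =
  (π' : TL M) → AT M (ext M C α i ∷C C) π' → Sat M (ext M C α i ∷C C) π' i φ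

Valid : Form → Set₁
Valid φ = (M : Model) (C : Context M) (π : TL M) → AT M C π → (i : ℕ) → Sat M C π i φ

{-# OPTIONS --safe #-}
module Submission where

-- Formulas of Φ_XY never inspect the context, so the announcement [α] merely keeps
-- the timelines satisfying α at the current instant, and each of them satisfies α
-- there. On the other hand, α → □α fails in the model consisting of a root with two
-- infinite branches, p holding exactly on the first one: at instant 1 of the first
-- branch p holds, but □ quantifies over all timelines, including the second branch.

open import Defs
open import Data.Bool using (Bool; true; false)
open import Data.Empty using (⊥-elim) renaming (⊥ to Empty)
open import Data.List using (List; []; _∷_; head; last)
open import Data.List.Relation.Unary.Linked using (Linked; [-]; _∷_)
open import Data.Maybe using (just)
open import Data.Nat using (ℕ; zero; suc; _≤_; _+_)
open import Data.Nat.Properties using (≤-refl; ≤-trans; n≤1+n; 1+n≰n; +-identityʳ; +-suc)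
open import Data.Product using (_×_; ∃; _,_)
open import Data.Unit using (tt) renaming (⊤ to Unit)
open import Relation.Binary.PropositionalEquality using (_≡_; refl; cong)
open import Relation.Nullary using (¬_)

mutual
  satXY⇒sat-ι : (M : Model) (C C′ : Context M) (π : TL M) (i : ℕ) (α : FormXY) →
                SatXY M C π i α → Sat M C′ π i (ι α)
  satXY⇒sat-ι M C C′ π i (atomXY p)  h         = h
  satXY⇒sat-ι M C C′ π i botXY       h         = h
  satXY⇒sat-ι M C C′ π i (negXY α)   h s       = h (sat-ι⇒satXY M C C′ π i α s)
  satXY⇒sat-ι M C C′ π i (andXY α β) (hα , hβ) =
    satXY⇒sat-ι M C C′ π i α hα , satXY⇒sat-ι M C C′ π i β hβ
  satXY⇒sat-ι M C C′ π i       (XXY α) h = satXY⇒sat-ι M C C′ π (suc i) α h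
  satXY⇒sat-ι M C C′ π zero    (YXY α) h = tt
  satXY⇒sat-ι M C C′ π (suc i) (YXY α) h = satXY⇒sat-ι M C C′ π i α h

  sat-ι⇒satXY : (M : Model) (C C′ : Context M) (π : TL M) (i : ℕ) (α : FormXY) →
                Sat M C′ π i (ι α) → SatXY M C π i α
  sat-ι⇒satXY M C C′ π i (atomXY p)  h         = h
  sat-ι⇒satXY M C C′ π i botXY       h         = h
  sat-ι⇒satXY M C C′ π i (negXY α)   h s       = h (satXY⇒sat-ι M C C′ π i α s)
  sat-ι⇒satXY M C C′ π i (andXY α β) (hα , hβ) =
    sat-ι⇒satXY M C C′ π i α hα , sat-ι⇒satXY M C C′ π i β hβ
  sat-ι⇒satXY M C C′ π i       (XXY α) h = sat-ι⇒satXY M C C′ π (suc i) α h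
  sat-ι⇒satXY M C C′ π zero    (YXY α) h = tt
  sat-ι⇒satXY M C C′ π (suc i) (YXY α) h = sat-ι⇒satXY M C C′ π i α h

box-self-valid : (α : FormXY) → Valid (box α (ι α))
box-self-valid α M C π _ i π′ (π′∈‖α‖ , _) =
  satXY⇒sat-ι M C (ext M C α i ∷C C) π′ i α π′∈‖α‖

data Node : Set where
  base   : Node
  branch : Bool → ℕ → Node

data _≺_ : Node → Node → Set where
  base≺   : ∀ b → base ≺ branch b 0
  branch≺ : ∀ b n → branch b n ≺ branch b (suc n)

data _≼_ : Node → Node → Set where
  base≼   : ∀ w → base ≼ w
  branch≼ : ∀ b {m n} → m ≤ n → branch b m ≼ branch b n

≼-refl : ∀ w → w ≼ w
≼-refl base         = base≼ base
≼-refl (branch b n) = branch≼ b ≤-refl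

≺-≼-trans : ∀ {x y w} → x ≺ y → y ≼ w → x ≼ w
≺-≼-trans (base≺ b)     _                = base≼ _
≺-≼-trans (branch≺ b n) (branch≼ .b 1+n≤m) = branch≼ b (≤-trans (n≤1+n n) 1+n≤m)

≺-≼-asym : ∀ {x y} → x ≺ y → ¬ (y ≼ x)
≺-≼-asym (base≺ b)     ()
≺-≼-asym (branch≺ b n) (branch≼ .b 1+n≤n) = 1+n≰n 1+n≤n

≺-unique-towards : ∀ {x y z w} → x ≺ y → x ≺ z → y ≼ w → z ≼ w → y ≡ z
≺-unique-towards (base≺ b)     (base≺ .b)       (branch≼ .b _) (branch≼ .b _) = refl
≺-unique-towards (branch≺ b n) (branch≺ .b .n) _              _              = refl

linked-head-≼-last : ∀ x xs {w} → Linked _≺_ (x ∷ xs) → last (x ∷ xs) ≡ just w → x ≼ w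
linked-head-≼-last x []       _       refl = ≼-refl x
linked-head-≼-last x (y ∷ xs) (x≺y ∷ l) eq = ≺-≼-trans x≺y (linked-head-≼-last y xs l eq)

linked-unique : ∀ x xs ys {w} → Linked _≺_ (x ∷ xs) → Linked _≺_ (x ∷ ys) →
                last (x ∷ xs) ≡ just w → last (x ∷ ys) ≡ just w → xs ≡ ys
linked-unique x []       []       _         _         _    _    = refl
linked-unique x []       (z ∷ zs) _         (x≺z ∷ l) refl eqz =
  ⊥-elim (≺-≼-asym x≺z (linked-head-≼-last z zs l eqz))
linked-unique x (y ∷ ys) []       (x≺y ∷ l) _         eqy  refl =
  ⊥-elim (≺-≼-asym x≺y (linked-head-≼-last y ys l eqy))
linked-unique x (y ∷ ys) (z ∷ zs) (x≺y ∷ l) (x≺z ∷ m) eqy  eqz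
  with ≺-unique-towards x≺y x≺z (linked-head-≼-last y ys l eqy) (linked-head-≼-last z zs m eqz)
... | refl = cong (y ∷_) (linked-unique y ys zs l m eqy eqz)

segment : Bool → ℕ → ℕ → List Node
segment b k zero    = branch b k ∷ []
segment b k (suc m) = branch b k ∷ segment b (suc k) m

segment-linked : ∀ {x} b k m → x ≺ branch b k → Linked _≺_ (x ∷ segment b k m)
segment-linked b k zero    x≺ = x≺ ∷ [-]
segment-linked b k (suc m) x≺ = x≺ ∷ segment-linked b (suc k) m (branch≺ b k)

segment-last : ∀ x b k m → last (x ∷ segment b k m) ≡ just (branch b (k + m))
segment-last x b k zero    rewrite +-identityʳ k = refl
segment-last x b k (suc m) rewrite +-suc k m     = segment-last (branch b k) b (suc k) m

chains-from-base-unique : ∀ w xs ys →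
  head xs ≡ just base × last xs ≡ just w × Linked _≺_ xs →
  head ys ≡ just base × last ys ≡ just w × Linked _≺_ ys → xs ≡ ys
chains-from-base-unique w (.base ∷ xs) (.base ∷ ys) (refl , eqx , lx) (refl , eqy , ly) =
  cong (base ∷_) (linked-unique base xs ys lx ly eqx eqy)
chains-from-base-unique w []      _  (() , _) _
chains-from-base-unique w (_ ∷ _) [] _        (() , _)

twoBranches : Model
twoBranches = record
  { W           = Node
  ; _<_         = _≺_
  ; serial      = λ { base → branch false 0 , base≺ false
                    ; (branch b n) → branch b (suc n) , branch≺ b n }
  ; root        = base
  ; chainExists = λ { base → base ∷ [] , refl , refl , [-]
                    ; (branch b n) → base ∷ segment b 0 n , refl , segment-last base b 0 n
                                   , segment-linked b 0 n (base≺ b) }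
  ; chainUnique = chains-from-base-unique
  ; V           = λ { _ (branch true _) → Unit ; _ _ → Empty }
  }

branchLine : Bool → TL twoBranches
branchLine b = record { seq = position ; start = refl ; step = advance }
  where
  position : ℕ → Node
  position zero    = base
  position (suc n) = branch b n
  advance : ∀ k → position k ≺ position (suc k)
  advance zero    = base≺ b
  advance (suc k) = branch≺ b k

atom⇒□atom-not-valid : (p : AP) → ¬ Valid (ι (atomXY p) ⇒ □ (ι (atomXY p)))
atom⇒□atom-not-valid p valid =
  valid twoBranches [] (branchLine true) tt 1
    (tt , λ □p → □p (branchLine false) ((λ ()) , tt))

fact1 : ((α : FormXY) → Valid (box α (ι α))) × (∃ λ (α : FormXY) → ¬ Valid (ι α ⇒ □ (ι α)))
fact1 = box-self-valid , (atomXY 0 , atom⇒□atom-not-valid 0)
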